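{- There exists an integer $N$ such that for all integers $n \geq N$, \[ P(g(n)) = \min\Big\{P(g(n)),\ \sqrt{2(g(n)+f(n)+1)} + 1/2\Big\} \] and \[ Q(g(n)) = \min\Big\{Q(g(n)),\ \sqrt{2(g(n)+f(n)+1)} + 3/2,\ f(n) - 2\Big\}. \] Moreover, these claims hold with $N = 2{,}500{,}000$.
   Context: For $A \subseteq \{0,1,2,\ldots\}$, $\partial A = \{z \in A : \{z-1,z+1\} \not\subseteq A\}$, $vol(A)=\sum_{z\in A} z$, $per(A) = \sum_{z \in \partial A} z$ (both $0$ for the empty set), and $A^c = \{0,1,2,\ldots\}\setminus A$. For integers $n\ge 0$, $P(n) = \min\{per(A) : A \subseteq \{0,1,\ldots\},\ vol(A)=n\}$ and $Q(n) = \min\{per(A^c) : A \subseteq \{0,1,\ldots\},\ vol(A) = n\}$. Also $f(n) = \lceil (-1+\sqrt{1+8n})/2 \rceil$ and $g(n) = f(n)(f(n)+1)/2 - n$. -}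

module Defs where

open import Data.Nat using (ℕ; zero; suc; _+_; _*_; _∸_; _≤_; _<_; _≤ᵇ_)
open import Data.Nat.DivMod using (_/_)
open import Data.Bool using (Bool; true; false; not; _∧_; if_then_else_)
open import Data.List using (List; []; _∷_; length)
open import Data.Product using (_×_)

-- A finite subset A ⊆ {0,1,2,...} is represented by a list of booleans:
-- z ∈ A  iff  z < length xs and the z-th entry is true.
-- Every finite subset has such a representation (non-unique: trailing
-- falses), and every set with a finite volume is finite, so quantifying
-- over lists of booleans is the same as quantifying over all A with vol(A) = n.
mem : List Bool → ℕ → Bool
mem []       _       = false
mem (b ∷ _)  zero    = b
mem (_ ∷ bs) (suc z) = mem bs z

sumTo : ℕ → (ℕ → ℕ) → ℕ
sumTo zero    h = 0
sumTo (suc B) h = sumTo B h + h B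

predIn : (ℕ → Bool) → ℕ → Bool
predIn S zero    = false
predIn S (suc k) = S k

inBoundary : (ℕ → Bool) → ℕ → Bool
inBoundary S z = S z ∧ not (predIn S z ∧ S (suc z))

perUpTo : (ℕ → Bool) → ℕ → ℕ
perUpTo S B = sumTo B (λ z → if inBoundary S z then z else 0)

vol : List Bool → ℕ
vol xs = sumTo (length xs) (λ z → if mem xs z then z else 0)

-- per(A): all elements of A (hence of ∂A) are < length xs
per : List Bool → ℕ
per xs = perUpTo (mem xs) (length xs)

compl : List Bool → ℕ → Bool
compl xs z = not (mem xs z)

-- per(A^c): if z ≥ length xs + 1 then z-1, z, z+1 ∈ A^c, so z ∉ ∂(A^c);
-- hence ∂(A^c) ⊆ {0, ..., length xs} and the truncated sum is exact.
perC : List Bool → ℕ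
perC xs = perUpTo (compl xs) (suc (length xs))

IsP : ℕ → ℕ → Set
IsP n m = (Data.Product.Σ (List Bool) λ A → (vol A Relation.Binary.PropositionalEquality.≡ n) × (per A Relation.Binary.PropositionalEquality.≡ m))
        × ((A : List Bool) → vol A Relation.Binary.PropositionalEquality.≡ n → m ≤ per A)
  where import Relation.Binary.PropositionalEquality
        import Data.Product

IsQ : ℕ → ℕ → Set
IsQ n m = (Data.Product.Σ (List Bool) λ A → (vol A Relation.Binary.PropositionalEquality.≡ n) × (perC A Relation.Binary.PropositionalEquality.≡ m))
        × ((A : List Bool) → vol A Relation.Binary.PropositionalEquality.≡ n → m ≤ perC A)
  where import Relation.Binary.PropositionalEquality
        import Data.Product

-- least k < B with p k, or B if none
leastBelow : (ℕ → Bool) → ℕ → ℕ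
leastBelow p zero    = 0
leastBelow p (suc B) = if p 0 then 0 else suc (leastBelow (λ k → p (suc k)) B)

-- f(n) = ⌈(-1 + √(1+8n))/2⌉ = least k ∈ ℕ with (2k+1)² ≥ 1 + 8n, i.e. with 2n ≤ k(k+1).
-- k = n always qualifies, so searching below n+1 suffices.
f : ℕ → ℕ
f n = leastBelow (λ k → (2 * n) ≤ᵇ (k * (k + 1))) (suc n)

-- g(n) = f(n)(f(n)+1)/2 - n   (nonnegative since f(n)(f(n)+1) ≥ 2n)
g : ℕ → ℕ
g n = ((f n * (f n + 1)) / 2) ∸ n

-- x ≤ √(2y) + 1/2   for x ∈ ℕ   ⟺   x = 0 or (2x-1)² ≤ 8y
LeSqrtPlusHalf : ℕ → ℕ → Set
LeSqrtPlusHalf x y = (x ≡ 0) ⊎ (((2 * x ∸ 1) * (2 * x ∸ 1)) ≤ 8 * y)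
  where open import Relation.Binary.PropositionalEquality using (_≡_)
        open import Data.Sum using (_⊎_)

-- x ≤ √(2y) + 3/2   for x ∈ ℕ   ⟺   x ≤ 1 or (2x-3)² ≤ 8y
LeSqrtPlusThreeHalves : ℕ → ℕ → Set
LeSqrtPlusThreeHalves x y = (x ≤ 1) ⊎ (((2 * x ∸ 3) * (2 * x ∸ 3)) ≤ 8 * y)
  where open import Data.Sum using (_⊎_)

{-# OPTIONS --safe #-}
-- Write m = g n greedily as r + (e + 1) + (e + 2) + ⋯ + K, where K is largest with tri K < m
-- and e, r < e (or r = 0) come from bracketing the gap tri (K + 1) − m the same way. Take
-- A = B ∪ [e + 1, K] with B ⊆ [0, e) of volume r: the interval adds at most (e + 1) + K to the
-- perimeter of A and to that of its complement, and by strong induction on the volume B can be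
-- chosen with both perimeters at most r + 2 ≤ e + 1. So P (g n) and Q (g n) are at most
-- W = 2e + 2 + K. Since tri e < K, W = K + O(√K), while tri K < g n < f n; this gives
-- (2W − 1)² ≤ 8 (g n + f n + 1) and W + 2 ≤ f n, by polynomial identities once K ≥ 6e + 6 and by
-- a finite check for K < 84, where n ≥ 2500000 supplies f n ≥ 2236.
module Submission where

open import Defs
open import Data.Bool using (Bool; true; false; not; _∧_; if_then_else_; T)
open import Data.Empty using (⊥-elim)
open import Data.Fin using (Fin; toℕ; fromℕ<)
open import Data.Fin.Properties using (all?; toℕ-fromℕ<)
open import Data.List using (List; []; _∷_; length; _++_; replicate; map)
open import Data.List.Properties
  using (length-++; length-replicate; length-map; map-++; map-replicate; ++-assoc)
open import Data.Nat
open import Data.Nat.DivMod using (_/_; m*n/n≡m)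
open import Data.Nat.Induction using (<-rec)
open import Data.Nat.Properties
open import Data.Nat.Tactic.RingSolver using (solve-∀)
open import Data.Product using (_×_; _,_; proj₂; ∃-syntax)
open import Data.Sum using (_⊎_; inj₁; inj₂)
open import Data.Unit using (tt)
open import Function using (_∘_)
open import Relation.Binary.PropositionalEquality
open import Relation.Nullary using (¬_; yes; no)
open import Relation.Nullary.Decidable using (_×-dec_; _→-dec_; from-yes)

tri : ℕ → ℕ
tri zero    = 0
tri (suc k) = tri k + k

tri-double : ∀ k → 2 * tri (suc k) ≡ k * suc k
tri-double zero    = refl
tri-double (suc k) = begin
  2 * (tri (suc k) + suc k)    ≡⟨ *-distribˡ-+ 2 (tri (suc k)) (suc k) ⟩
  2 * tri (suc k) + 2 * suc k  ≡⟨ cong (_+ 2 * suc k) (tri-double k) ⟩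
  k * suc k + 2 * suc k        ≡⟨ arithmetic k ⟩
  suc k * suc (suc k)          ∎
  where
  open ≡-Reasoning
  arithmetic : ∀ k → k * suc k + 2 * suc k ≡ suc k * suc (suc k)
  arithmetic = solve-∀

tri-mono-≤ : ∀ {a b} → a ≤ b → tri a ≤ tri b
tri-mono-≤ {zero}          _         = z≤n
tri-mono-≤ {suc a} {suc b} (s≤s a≤b) = +-mono-≤ (tri-mono-≤ a≤b) a≤b

n≤1+tri : ∀ n → n ≤ suc (tri n)
n≤1+tri zero    = z≤n
n≤1+tri (suc n) = s≤s (m≤n+m n (tri n))

3+n≤tri : ∀ t → 3 + t ≤ tri (3 + t)
3+n≤tri zero    = ≤-refl
3+n≤tri (suc t) = +-monoˡ-≤ (3 + t) (≤-trans (s≤s z≤n) (3+n≤tri t))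

tri-bracket : ∀ x → 1 ≤ x → ∃[ K ] tri K < x × x ≤ tri (suc K)
tri-bracket (suc zero)    _ = 1 , s≤s z≤n , s≤s z≤n
tri-bracket (suc (suc y)) _ with tri-bracket (suc y) (s≤s z≤n)
... | K , lo , hi with suc (suc y) ≤? tri (suc K)
...   | yes hi′ = K , m<n⇒m<1+n lo , hi′
...   | no ¬hi′ = suc K , ≤-reflexive (cong suc tri[1+K]≡) , hi″
  where
  tri[1+K]≡ : tri (suc K) ≡ suc y
  tri[1+K]≡ = ≤-antisym (≤-pred (≰⇒> ¬hi′)) hi
  hi″ : suc (suc y) ≤ tri (suc K) + suc K
  hi″ = begin
    suc (suc y)           ≡⟨ cong suc (sym tri[1+K]≡) ⟩
    suc (tri (suc K))     ≤⟨ s≤s (m≤m+n (tri (suc K)) K) ⟩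
    suc (tri (suc K) + K) ≡⟨ sym (+-suc (tri (suc K)) K) ⟩
    tri (suc K) + suc K   ∎
    where open ≤-Reasoning

<-of-split-tri : ∀ {a b} k → a + b ≡ tri (suc k) → tri k < b → a < k
<-of-split-tri {a} {b} k eq tri-k<b = +-cancelʳ-< (tri k) a k (begin-strict
  a + tri k  <⟨ +-monoʳ-< a tri-k<b ⟩
  a + b      ≡⟨ trans eq (+-comm (tri k) k) ⟩
  k + tri k  ∎)
  where open ≤-Reasoning

-- Volume and perimeter of a list by scanning

sumTo-cong : ∀ B {h h′ : ℕ → ℕ} → (∀ z → h z ≡ h′ z) → sumTo B h ≡ sumTo B h′
sumTo-cong zero    eq = refl
sumTo-cong (suc B) eq = cong₂ _+_ (sumTo-cong B eq) (eq B)

sumTo-suc : ∀ B (h : ℕ → ℕ) → sumTo (suc B) h ≡ h 0 + sumTo B (h ∘ suc)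
sumTo-suc zero    h = +-comm 0 (h 0)
sumTo-suc (suc B) h = trans (cong (_+ h (suc B)) (sumTo-suc B h)) (+-assoc (h 0) _ _)

if-then-0-≤ : ∀ b s → (if b then s else 0) ≤ s
if-then-0-≤ true  s = ≤-refl
if-then-0-≤ false s = z≤n

memOr : Bool → List Bool → ℕ → Bool
memOr d []       _       = d
memOr d (b ∷ _)  zero    = b
memOr d (_ ∷ bs) (suc z) = memOr d bs z

mem≗memOr : ∀ xs z → mem xs z ≡ memOr false xs z
mem≗memOr []       z       = refl
mem≗memOr (x ∷ xs) zero    = refl
mem≗memOr (x ∷ xs) (suc z) = mem≗memOr xs z

compl≗memOr : ∀ xs z → compl xs z ≡ memOr true (map not xs ++ true ∷ []) z
compl≗memOr []       zero    = refl
compl≗memOr []       (suc z) = refl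
compl≗memOr (x ∷ xs) zero    = refl
compl≗memOr (x ∷ xs) (suc z) = compl≗memOr xs z

memOr-++-head : ∀ d xs ys → memOr d (xs ++ ys) 0 ≡ memOr (memOr d ys 0) xs 0
memOr-++-head d []      ys = refl
memOr-++-head d (x ∷ _) ys = refl

lastOr : Bool → List Bool → Bool
lastOr p []       = p
lastOr p (x ∷ xs) = lastOr x xs

-- Scans of a list whose first cell sits at position s; for the perimeter,
-- p is the cell at s - 1 and d the value of every cell after the list.
volScan : ℕ → List Bool → ℕ
volScan s []       = 0
volScan s (x ∷ xs) = (if x then s else 0) + volScan (suc s) xs

perScan : ℕ → Bool → Bool → List Bool → ℕ
perScan s p d []       = 0
perScan s p d (y ∷ ys) = (if y ∧ not (p ∧ memOr d ys 0) then s else 0) + perScan (suc s) y d ys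

volScan-sumTo : ∀ s xs → sumTo (length xs) (λ z → if mem xs z then s + z else 0) ≡ volScan s xs
volScan-sumTo s []       = refl
volScan-sumTo s (x ∷ xs) =
  trans (sumTo-suc (length xs) _)
    (cong₂ _+_ (cong (λ v → if x then v else 0) (+-identityʳ s))
      (trans (sumTo-cong (length xs) (λ z → cong (λ v → if mem xs z then v else 0) (+-suc s z)))
             (volScan-sumTo (suc s) xs)))

vol≡volScan : ∀ A → vol A ≡ volScan 0 A
vol≡volScan = volScan-sumTo 0

prevOr : Bool → (ℕ → Bool) → ℕ → Bool
prevOr p S zero    = p
prevOr p S (suc z) = S z

boundaryTerm : ℕ → Bool → (ℕ → Bool) → ℕ → ℕ
boundaryTerm s p S z = if S z ∧ not (prevOr p S z ∧ S (suc z)) then s + z else 0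

perScan-sumTo : ∀ s p d ys → sumTo (length ys) (boundaryTerm s p (memOr d ys)) ≡ perScan s p d ys
perScan-sumTo s p d []       = refl
perScan-sumTo s p d (y ∷ ys) =
  trans (sumTo-suc (length ys) (boundaryTerm s p (memOr d (y ∷ ys))))
    (cong₂ _+_ (cong (λ v → if y ∧ not (p ∧ memOr d ys 0) then v else 0) (+-identityʳ s))
      (trans (sumTo-cong (length ys) shift) (perScan-sumTo (suc s) y d ys)))
  where
  shift : ∀ z → boundaryTerm s p (memOr d (y ∷ ys)) (suc z) ≡ boundaryTerm (suc s) y (memOr d ys) z
  shift zero    = cong (λ v → if memOr d ys 0 ∧ not (y ∧ memOr d ys 1) then v else 0) (+-suc s 0)
  shift (suc z) =
    cong (λ v → if memOr d ys (suc z) ∧ not (memOr d ys z ∧ memOr d ys (suc (suc z))) then v else 0)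
         (+-suc s (suc z))

boundaryTerm-inBoundary : ∀ {S S′ : ℕ → Bool} → (∀ z → S z ≡ S′ z) →
                          ∀ z → (if inBoundary S z then z else 0) ≡ boundaryTerm 0 false S′ z
boundaryTerm-inBoundary S≗S′ zero    rewrite S≗S′ 0 = refl
boundaryTerm-inBoundary S≗S′ (suc z) rewrite S≗S′ z | S≗S′ (suc z) | S≗S′ (suc (suc z)) = refl

per≡perScan : ∀ A → per A ≡ perScan 0 false false A
per≡perScan A = trans (sumTo-cong (length A) (boundaryTerm-inBoundary (mem≗memOr A)))
                      (perScan-sumTo 0 false false A)

length-complement : ∀ A → length (map not A ++ true ∷ []) ≡ suc (length A)
length-complement A =
  trans (length-++ (map not A)) (trans (+-comm (length (map not A)) 1) (cong suc (length-map not A)))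

perC≡perScan : ∀ A → perC A ≡ perScan 0 false true (map not A ++ true ∷ [])
perC≡perScan A =
  trans (sumTo-cong (suc (length A)) (boundaryTerm-inBoundary (compl≗memOr A)))
    (trans (cong (λ L → sumTo L (boundaryTerm 0 false (memOr true Aᶜ))) (sym (length-complement A)))
           (perScan-sumTo 0 false true Aᶜ))
  where
  Aᶜ : List Bool
  Aᶜ = map not A ++ true ∷ []

volScan-++ : ∀ s xs ys → volScan s (xs ++ ys) ≡ volScan s xs + volScan (s + length xs) ys
volScan-++ s []       ys = cong (λ t → volScan t ys) (sym (+-identityʳ s))
volScan-++ s (x ∷ xs) ys rewrite volScan-++ (suc s) xs ys | +-suc s (length xs) =
  sym (+-assoc (if x then s else 0) (volScan (suc s) xs) _)

perScan-++ : ∀ s p d xs ys →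
             perScan s p d (xs ++ ys)
               ≡ perScan s p (memOr d ys 0) xs + perScan (s + length xs) (lastOr p xs) d ys
perScan-++ s p d []       ys = cong (λ t → perScan t p d ys) (sym (+-identityʳ s))
perScan-++ s p d (x ∷ xs) ys
  rewrite memOr-++-head d xs ys | perScan-++ (suc s) x d xs ys | +-suc s (length xs) =
  sym (+-assoc (if x ∧ not (p ∧ memOr (memOr d ys 0) xs 0) then s else 0)
               (perScan (suc s) x (memOr d ys 0) xs) _)

volScan-falses : ∀ s k → volScan s (replicate k false) ≡ 0
volScan-falses s zero    = refl
volScan-falses s (suc k) = volScan-falses (suc s) k

volScan-trues : ∀ s j → tri s + volScan s (replicate j true) ≡ tri (s + j)
volScan-trues s zero    = trans (+-identityʳ (tri s)) (cong tri (sym (+-identityʳ s)))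
volScan-trues s (suc j) = begin
  tri s + (s + volScan (suc s) (replicate j true))  ≡⟨ sym (+-assoc (tri s) s _) ⟩
  tri (suc s) + volScan (suc s) (replicate j true)  ≡⟨ volScan-trues (suc s) j ⟩
  tri (suc s + j)                                   ≡⟨ cong tri (sym (+-suc s j)) ⟩
  tri (s + suc j)                                   ∎
  where open ≡-Reasoning

perScan-∷-≤ : ∀ s p d y ys → perScan s p d (y ∷ ys) ≤ s + perScan (suc s) y d ys
perScan-∷-≤ s p d y ys = +-monoˡ-≤ _ (if-then-0-≤ (y ∧ not (p ∧ memOr d ys 0)) s)

perScan-prev-≤ : ∀ s p d ys → perScan s p d ys ≤ perScan s false d ys
perScan-prev-≤ s p d []       = z≤n
perScan-prev-≤ s p d (y ∷ ys) = +-monoˡ-≤ _ (cellTerm-≤ y p (memOr d ys 0))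
  where
  cellTerm-≤ : ∀ y p h → (if y ∧ not (p ∧ h) then s else 0) ≤ (if y ∧ not (false ∧ h) then s else 0)
  cellTerm-≤ false p     h     = z≤n
  cellTerm-≤ true  false h     = ≤-refl
  cellTerm-≤ true  true  false = ≤-refl
  cellTerm-≤ true  true  true  = z≤n

perScan-falses : ∀ s p d k ys → perScan s p d (replicate k false ++ ys) ≤ perScan (s + k) false d ys
perScan-falses s p d zero    ys rewrite +-identityʳ s = perScan-prev-≤ s p d ys
perScan-falses s p d (suc k) ys rewrite +-suc s k = perScan-falses (suc s) false d k ys

perScan-trues : ∀ s d k ys →
                perScan s true d (replicate (suc k) true ++ ys) ≤ s + k + perScan (suc (s + k)) true d ys
perScan-trues s d zero    ys rewrite +-identityʳ s = perScan-∷-≤ s true d true ys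
perScan-trues s d (suc k) ys rewrite +-suc s k = perScan-trues (suc s) d k ys

perScan-trueTail : ∀ s j → perScan s true false (replicate (suc j) true) ≤ s + j
perScan-trueTail s zero    = ≤-refl
perScan-trueTail s (suc j) rewrite +-suc s j = perScan-trueTail (suc s) j

perScan-trueBlock : ∀ s p j → perScan s p false (replicate (suc j) true) ≤ s + (s + j)
perScan-trueBlock s p j =
  ≤-trans (perScan-∷-≤ s p false true (replicate j true)) (+-monoʳ-≤ s (tail j))
  where
  tail : ∀ j → perScan (suc s) true false (replicate j true) ≤ s + j
  tail zero    = z≤n
  tail (suc j) rewrite +-suc s j = perScan-trueTail (suc s) j

perScan-falsesThenTrue : ∀ s p i → perScan s p true (replicate i false ++ true ∷ []) ≤ s + i
perScan-falsesThenTrue s p i =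
  ≤-trans (perScan-falses s p true i (true ∷ [])) (≤-reflexive (+-identityʳ (s + i)))

perScan-complementBlock : ∀ s p k j →
  perScan s p true (replicate (suc k) true ++ replicate (suc j) false ++ true ∷ [])
    ≤ perScan s p true (true ∷ []) + (suc (s + k) + (suc (s + k) + j))
perScan-complementBlock s p zero j = begin
  perScan s p true (true ∷ replicate (suc j) false ++ true ∷ [])
    ≤⟨ perScan-∷-≤ s p true true (replicate (suc j) false ++ true ∷ []) ⟩
  s + perScan (suc s) true true (replicate (suc j) false ++ true ∷ [])
    ≤⟨ +-monoʳ-≤ s (perScan-falsesThenTrue (suc s) true (suc j)) ⟩
  s + (suc s + suc j)
    ≡⟨ arithmetic s j ⟩
  suc (s + 0) + (suc (s + 0) + j)
    ≤⟨ m≤n+m _ _ ⟩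
  perScan s p true (true ∷ []) + (suc (s + 0) + (suc (s + 0) + j)) ∎
  where
  open ≤-Reasoning
  arithmetic : ∀ s j → s + (suc s + suc j) ≡ suc (s + 0) + (suc (s + 0) + j)
  arithmetic = solve-∀
perScan-complementBlock s p (suc k) j = begin
  cell + perScan (suc s) true true (replicate (suc k) true ++ replicate (suc j) false ++ true ∷ [])
    ≤⟨ +-monoʳ-≤ cell (perScan-trues (suc s) true k (replicate (suc j) false ++ true ∷ [])) ⟩
  cell + (suc s + k + perScan (suc (suc s + k)) true true (replicate (suc j) false ++ true ∷ []))
    ≤⟨ +-monoʳ-≤ cell (+-monoʳ-≤ (suc s + k) (perScan-falsesThenTrue (suc (suc s + k)) true (suc j))) ⟩
  cell + (suc s + k + (suc (suc s + k) + suc j))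
    ≡⟨ cong₂ _+_ (sym (+-identityʳ cell)) (arithmetic s k j) ⟩
  cell + 0 + (suc (s + suc k) + (suc (s + suc k) + j)) ∎
  where
  open ≤-Reasoning
  cell : ℕ
  cell = if true ∧ not (p ∧ true) then s else 0
  arithmetic : ∀ s k j → suc s + k + (suc (suc s + k) + suc j) ≡ suc (s + suc k) + (suc (s + suc k) + j)
  arithmetic = solve-∀

-- Adding an interval to a set

-- The set B ∪ [e + 1, K], where e = length B + k and K = suc e + j.
extend : List Bool → ℕ → ℕ → List Bool
extend B k j = B ++ replicate (suc k) false ++ replicate (suc j) true

length-extend : ∀ B k j → length (extend B k j) ≡ suc (suc (length B + k) + j)
length-extend B k j =
  trans (length-++ B)
    (trans (cong (length B +_) (trans (length-++ (replicate (suc k) false))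
                                      (cong₂ _+_ (length-replicate (suc k)) (length-replicate (suc j)))))
           (arithmetic (length B) k j))
  where
  arithmetic : ∀ L k j → L + (suc k + suc j) ≡ suc (suc (L + k) + j)
  arithmetic = solve-∀

vol-extend : ∀ B k j → vol (extend B k j) + tri (suc (length B + k))
                       ≡ vol B + tri (suc (suc (length B + k) + j))
vol-extend B k j = begin
  vol (extend B k j) + tri (suc e)
    ≡⟨ cong (_+ tri (suc e)) (trans (vol≡volScan (extend B k j)) (volScan-++ 0 B (Fs ++ Ts))) ⟩
  volScan 0 B + volScan (length B) (Fs ++ Ts) + tri (suc e)
    ≡⟨ cong (λ v → volScan 0 B + v + tri (suc e)) blockVolume ⟩
  volScan 0 B + volScan (suc e) Ts + tri (suc e)
    ≡⟨ trans (+-assoc (volScan 0 B) _ _) (cong (volScan 0 B +_) (+-comm (volScan (suc e) Ts) _)) ⟩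
  volScan 0 B + (tri (suc e) + volScan (suc e) Ts)
    ≡⟨ cong₂ _+_ (sym (vol≡volScan B)) (volScan-trues (suc e) (suc j)) ⟩
  vol B + tri (suc e + suc j)
    ≡⟨ cong (λ t → vol B + tri t) (+-suc (suc e) j) ⟩
  vol B + tri (suc (suc e + j)) ∎
  where
  open ≡-Reasoning
  e : ℕ
  e = length B + k
  Fs Ts : List Bool
  Fs = replicate (suc k) false
  Ts = replicate (suc j) true
  blockVolume : volScan (length B) (Fs ++ Ts) ≡ volScan (suc e) Ts
  blockVolume = trans (volScan-++ (length B) Fs Ts)
    (cong₂ _+_ (volScan-falses (length B) (suc k))
               (cong (λ t → volScan t Ts)
                     (trans (cong (length B +_) (length-replicate (suc k))) (+-suc (length B) k))))

per-extend : ∀ B k j → per (extend B k j) ≤ per B + (suc (length B + k) + (suc (length B + k) + j))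
per-extend B k j = begin
  per (extend B k j)
    ≡⟨ trans (per≡perScan (extend B k j)) (perScan-++ 0 false false B (Fs ++ Ts)) ⟩
  perScan 0 false false B + perScan (length B) (lastOr false B) false (Fs ++ Ts)
    ≤⟨ +-mono-≤ (≤-reflexive (sym (per≡perScan B))) (perScan-falses (length B) (lastOr false B) false (suc k) Ts) ⟩
  per B + perScan (length B + suc k) false false Ts
    ≤⟨ +-monoʳ-≤ (per B) (perScan-trueBlock (length B + suc k) false j) ⟩
  per B + (length B + suc k + (length B + suc k + j))
    ≡⟨ cong (λ t → per B + (t + (t + j))) (+-suc (length B) k) ⟩
  per B + (suc (length B + k) + (suc (length B + k) + j)) ∎
  where
  open ≤-Reasoning
  Fs Ts : List Bool
  Fs = replicate (suc k) false
  Ts = replicate (suc j) true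

complement-extend : ∀ B k j → map not (extend B k j) ++ true ∷ []
                              ≡ map not B ++ replicate (suc k) true ++ replicate (suc j) false ++ true ∷ []
complement-extend B k j = begin
  map not (B ++ Fs ++ Ts) ++ true ∷ []
    ≡⟨ cong (_++ true ∷ []) (trans (map-++ not B (Fs ++ Ts))
         (cong (map not B ++_) (trans (map-++ not Fs Ts)
           (cong₂ _++_ (map-replicate not (suc k) false) (map-replicate not (suc j) true))))) ⟩
  (map not B ++ Fsᶜ ++ Tsᶜ) ++ true ∷ []
    ≡⟨ ++-assoc (map not B) (Fsᶜ ++ Tsᶜ) (true ∷ []) ⟩
  map not B ++ (Fsᶜ ++ Tsᶜ) ++ true ∷ []
    ≡⟨ cong (map not B ++_) (++-assoc Fsᶜ Tsᶜ (true ∷ [])) ⟩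
  map not B ++ Fsᶜ ++ Tsᶜ ++ true ∷ [] ∎
  where
  open ≡-Reasoning
  Fs Ts Fsᶜ Tsᶜ : List Bool
  Fs  = replicate (suc k) false
  Ts  = replicate (suc j) true
  Fsᶜ = replicate (suc k) true
  Tsᶜ = replicate (suc j) false

perC-extend : ∀ B k j → perC (extend B k j) ≤ perC B + (suc (length B + k) + (suc (length B + k) + j))
perC-extend B k j = begin
  perC (extend B k j)
    ≡⟨ trans (perC≡perScan (extend B k j)) (cong (perScan 0 false true) (complement-extend B k j)) ⟩
  perScan 0 false true (Bᶜ ++ block)
    ≡⟨ perScan-++ 0 false true Bᶜ block ⟩
  front + perScan (length Bᶜ) q true block
    ≤⟨ +-monoʳ-≤ front (perScan-complementBlock (length Bᶜ) q k j) ⟩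
  front + (perScan (length Bᶜ) q true (true ∷ []) + (suc (length Bᶜ + k) + (suc (length Bᶜ + k) + j)))
    ≡⟨ sym (+-assoc front _ _) ⟩
  front + perScan (length Bᶜ) q true (true ∷ []) + (suc (length Bᶜ + k) + (suc (length Bᶜ + k) + j))
    ≡⟨ cong₂ _+_ (sym (trans (perC≡perScan B) (perScan-++ 0 false true Bᶜ (true ∷ []))))
                 (cong (λ L → suc (L + k) + (suc (L + k) + j)) (length-map not B)) ⟩
  perC B + (suc (length B + k) + (suc (length B + k) + j)) ∎
  where
  open ≤-Reasoning
  Bᶜ block : List Bool
  Bᶜ    = map not B
  block = replicate (suc k) true ++ replicate (suc j) false ++ true ∷ []
  front : ℕ
  front = perScan 0 false true Bᶜ
  q : Bool
  q = lastOr false Bᶜ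

PerimetersAtMost : ℕ → List Bool → Set
PerimetersAtMost w A = per A ≤ w × perC A ≤ w

PerimetersAtMost-mono : ∀ {w w′} A → w ≤ w′ → PerimetersAtMost w A → PerimetersAtMost w′ A
PerimetersAtMost-mono A w≤w′ (perA , perCA) = ≤-trans perA w≤w′ , ≤-trans perCA w≤w′

extend-realises : ∀ {m r e K w} B → vol B ≡ r → length B ≤ e → suc e ≤ K →
                  m + tri (suc e) ≡ r + tri (suc K) → PerimetersAtMost w B →
                  ∃[ A ] vol A ≡ m × length A ≡ suc K × PerimetersAtMost (w + (suc e + K)) A
extend-realises {m} {r} {e} {K} B volB lenB e<K volume (perB , perCB)
  with m≤n⇒∃[o]m+o≡n lenB | m≤n⇒∃[o]m+o≡n e<K
... | k , refl | j , refl =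
  extend B k j , volA , length-extend B k j ,
  ≤-trans (per-extend B k j) (+-monoˡ-≤ _ perB) , ≤-trans (perC-extend B k j) (+-monoˡ-≤ _ perCB)
  where
  volA : vol (extend B k j) ≡ m
  volA = +-cancelʳ-≡ (tri (suc e)) (vol (extend B k j)) m
           (trans (vol-extend B k j) (trans (cong (_+ tri (suc K)) volB) (sym volume)))

-- The greedy decomposition

2+tri[e]≤K⇒2+e≤K : ∀ e {K} → 4 ≤ K → 2 + tri e ≤ K → 2 + e ≤ K
2+tri[e]≤K⇒2+e≤K zero                  4≤K _ = ≤-trans (s≤s (s≤s z≤n)) 4≤K
2+tri[e]≤K⇒2+e≤K (suc zero)            4≤K _ = ≤-trans (s≤s (s≤s (s≤s z≤n))) 4≤K
2+tri[e]≤K⇒2+e≤K (suc (suc zero))      4≤K _ = 4≤K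
2+tri[e]≤K⇒2+e≤K (suc (suc (suc t))) _   h = ≤-trans (+-monoʳ-≤ 2 (3+n≤tri t)) h

-- m = r + (e + 1) + ⋯ + K.
record Decomposition (m : ℕ) : Set where
  field
    e K r      : ℕ
    volume     : m + tri (suc e) ≡ r + tri (suc K)
    r-small    : r ≡ 0 ⊎ r < e
    2+tri[e]≤K : 2 + tri e ≤ K
    2+e≤K      : 2 + e ≤ K
    tri[K]<m   : tri K < m

  budget : r + (suc e + K) ≤ m
  budget = +-cancelʳ-≤ (tri (suc e)) (r + (suc e + K)) m (begin
    r + (suc e + K) + tri (suc e)   ≡⟨ +-assoc r _ _ ⟩
    r + (suc e + K + tri (suc e))   ≡⟨ cong (r +_) (+-comm (suc e + K) (tri (suc e))) ⟩
    r + (tri (suc e) + (suc e + K)) ≡⟨ cong (r +_) (sym (+-assoc (tri (suc e)) (suc e) K)) ⟩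
    r + (tri (suc (suc e)) + K)     ≤⟨ +-monoʳ-≤ r (+-monoˡ-≤ K (tri-mono-≤ 2+e≤K)) ⟩
    r + tri (suc K)                 ≡⟨ sym volume ⟩
    m + tri (suc e)                 ∎)
    where open ≤-Reasoning

decompose : ∀ m → 7 ≤ m → Decomposition m
decompose m 7≤m with tri-bracket m (≤-trans (s≤s z≤n) 7≤m)
... | K , tri[K]<m , m≤tri-suc-K = withGap (tri (suc K) ∸ m) (m∸n+n≡m m≤tri-suc-K)
  where
  4≤K : 4 ≤ K
  4≤K = ≮⇒≥ (λ K<4 → n≮n 6 (≤-trans (≤-trans 7≤m m≤tri-suc-K) (tri-mono-≤ K<4)))

  withGap : ∀ D → D + m ≡ tri (suc K) → Decomposition m
  withGap zero eq = record
    { e = 0 ; K = K ; r = 0 ; volume = trans (+-identityʳ m) eq ; r-small = inj₁ refl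
    ; 2+tri[e]≤K = 2≤K ; 2+e≤K = 2≤K ; tri[K]<m = tri[K]<m }
    where
    2≤K : 2 ≤ K
    2≤K = ≤-trans (s≤s (s≤s z≤n)) 4≤K
  withGap (suc D) eq with tri-bracket (suc D) (s≤s z≤n)
  ... | e , tri-e<D , D≤tri-suc-e = record
    { e = e ; K = K ; r = r ; volume = volume ; r-small = inj₂ (<-of-split-tri e r+D≡ tri-e<D)
    ; 2+tri[e]≤K = 2+tri[e]≤K ; 2+e≤K = 2+tri[e]≤K⇒2+e≤K e 4≤K 2+tri[e]≤K
    ; tri[K]<m = tri[K]<m }
    where
    r : ℕ
    r = tri (suc e) ∸ suc D
    r+D≡ : r + suc D ≡ tri (suc e)
    r+D≡ = m∸n+n≡m D≤tri-suc-e
    2+tri[e]≤K : 2 + tri e ≤ K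
    2+tri[e]≤K = ≤-trans (s≤s tri-e<D) (<-of-split-tri K eq tri[K]<m)
    volume : m + tri (suc e) ≡ r + tri (suc K)
    volume = begin
      m + tri (suc e)      ≡⟨ cong (m +_) (sym r+D≡) ⟩
      m + (r + suc D)      ≡⟨ arithmetic m r (suc D) ⟩
      r + (suc D + m)      ≡⟨ cong (r +_) eq ⟩
      r + tri (suc K)      ∎
      where
      open ≡-Reasoning
      arithmetic : ∀ m r d → m + (r + d) ≡ r + (d + m)
      arithmetic = solve-∀

LinearlyBounded : ℕ → Set
LinearlyBounded m = ∃[ A ] vol A ≡ m × length A ≤ suc m × PerimetersAtMost (m + 2) A

module _ {m : ℕ} (d : Decomposition m) where
  open Decomposition d

  remainderSet : LinearlyBounded r →
                 ∃[ B ] vol B ≡ r × length B ≤ e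
                      × PerimetersAtMost (r + 2) B × PerimetersAtMost (suc e) B
  remainderSet (B , volB , lenB , perimB) with r-small
  ... | inj₁ r≡0 = [] , sym r≡0 , z≤n , (z≤n , z≤n) , (z≤n , z≤n)
  ... | inj₂ r<e = B , volB , ≤-trans lenB r<e , perimB ,
                   PerimetersAtMost-mono B (≤-trans (≤-reflexive (+-comm r 2)) (s≤s r<e)) perimB

  decomposedSet : ∀ {w} B → vol B ≡ r → length B ≤ e → PerimetersAtMost w B →
                  ∃[ A ] vol A ≡ m × length A ≡ suc K × PerimetersAtMost (w + (suc e + K)) A
  decomposedSet B volB lenB = extend-realises B volB lenB (≤-trans (n≤1+n (suc e)) 2+e≤K) volume

  r<m : r < m
  r<m = ≤-trans (m<m+n r (s≤s z≤n)) budget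

  linearlyBounded-step : (∀ {m′} → m′ < m → LinearlyBounded m′) → LinearlyBounded m
  linearlyBounded-step rec with remainderSet (rec r<m)
  ... | B , volB , lenB , perimB , _ with decomposedSet {w = r + 2} B volB lenB perimB
  ...   | A , volA , lenA , perimA =
    A , volA , ≤-trans (≤-reflexive lenA) (s≤s (≤-trans (n≤1+tri K) tri[K]<m)) ,
    PerimetersAtMost-mono A (≤-trans (≤-reflexive (arithmetic r (suc e + K))) (+-monoˡ-≤ 2 budget))
                            perimA
    where
    arithmetic : ∀ r x → r + 2 + x ≡ r + x + 2
    arithmetic = solve-∀

linearlyBounded : ∀ m → LinearlyBounded m
linearlyBounded = <-rec LinearlyBounded realise
  where
  listed : ∀ A → T (length A ≤ᵇ suc (vol A)) → T (per A ≤ᵇ vol A + 2) → T (perC A ≤ᵇ vol A + 2) →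
           LinearlyBounded (vol A)
  listed A len perA perCA =
    A , refl , ≤ᵇ⇒≤ _ (suc (vol A)) len , ≤ᵇ⇒≤ _ (vol A + 2) perA , ≤ᵇ⇒≤ _ (vol A + 2) perCA
  realise : ∀ m → (∀ {m′} → m′ < m → LinearlyBounded m′) → LinearlyBounded m
  realise 0 _ = listed [] tt tt tt
  realise 1 _ = listed (false ∷ true ∷ []) tt tt tt
  realise 2 _ = listed (false ∷ false ∷ true ∷ []) tt tt tt
  realise 3 _ = listed (false ∷ true ∷ true ∷ []) tt tt tt
  realise 4 _ = listed (false ∷ true ∷ false ∷ true ∷ []) tt tt tt
  realise 5 _ = listed (false ∷ false ∷ true ∷ true ∷ []) tt tt tt
  realise 6 _ = listed (false ∷ true ∷ true ∷ true ∷ []) tt tt tt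
  realise m@(suc (suc (suc (suc (suc (suc (suc _))))))) rec =
    linearlyBounded-step (decompose m (s≤s (s≤s (s≤s (s≤s (s≤s (s≤s (s≤s z≤n)))))))) rec

width : ℕ → ℕ → ℕ
width e K = suc e + (suc e + K)

sharpSet : ∀ {m} (d : Decomposition m) → let open Decomposition d in
           ∃[ A ] vol A ≡ m × PerimetersAtMost (width e K) A
sharpSet d with remainderSet d (linearlyBounded (Decomposition.r d))
... | B , volB , lenB , _ , perimB with decomposedSet d B volB lenB perimB
...   | A , volA , _ , perimA = A , volA , perimA

-- The numerical inequality

-- A lower bound for f n when tri K < g n < f n and n ≥ 2500000.
fLower : ℕ → ℕ
fLower K = (2 + tri K) ⊔ 2236

WidthFits : ℕ → ℕ → Set
WidthFits K e = (2 * width e K ∸ 1) * (2 * width e K ∸ 1) ≤ 8 * (suc (tri K) + fLower K + 1)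
              × width e K + 2 ≤ fLower K

widthFits-table : (K : Fin 84) (e : Fin 14) → 2 + tri (toℕ e) ≤ toℕ K → WidthFits (toℕ K) (toℕ e)
widthFits-table = from-yes (all? {P = λ K → ∀ e → Admissible K e} λ K →
                            all? {P = Admissible K} λ e →
                              (2 + tri (toℕ e) ≤? toℕ K) →-dec ((_ ≤? _) ×-dec (_ ≤? _)))
  where
  Admissible : Fin 84 → Fin 14 → Set
  Admissible K e = 2 + tri (toℕ e) ≤ toℕ K → WidthFits (toℕ K) (toℕ e)

widthFits-small : ∀ {K e} → K < 84 → 2 + tri e ≤ K → WidthFits K e
widthFits-small {K} {e} K<84 h with e <? 14
... | no e≮14 = ⊥-elim (<⇒≱ K<84 (≤-trans (≤ᵇ⇒≤ 84 (2 + tri 14) tt)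
                                     (≤-trans (+-monoʳ-≤ 2 (tri-mono-≤ (≮⇒≥ e≮14))) h)))
... | yes e<14 = subst₂ WidthFits (toℕ-fromℕ< K<84) (toℕ-fromℕ< e<14)
                   (widthFits-table (fromℕ< K<84) (fromℕ< e<14)
                     (subst₂ (λ a b → 2 + tri b ≤ a) (sym (toℕ-fromℕ< K<84)) (sym (toℕ-fromℕ< e<14))
                             h))

widthFits-large : ∀ e d → WidthFits (suc (6 * e + 5 + d)) e
widthFits-large e d = squareFits , roomFits
  where
  X W t : ℕ
  X = 6 * e + 5 + d
  W = width e (suc X)
  t = tri (suc X)
  squareGap : ∀ e d → 8 * ((6 * e + 5 + d) * suc (6 * e + 5 + d)) + 32
                      ≡ 2 * (suc e + (suc e + suc (6 * e + 5 + d)))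
                          * (2 * (suc e + (suc e + suc (6 * e + 5 + d))))
                        + (32 * e * e + 16 * e + 32 * e * d + 16 + 24 * d + 4 * d * d)
  squareGap = solve-∀
  widthGap : ∀ e d → (6 * e + 5 + d) * suc (6 * e + 5 + d)
                     ≡ 2 * (suc e + (suc e + suc (6 * e + 5 + d)))
                       + (36 * e * e + 50 * e + 12 * e * d + 14 + 9 * d + d * d)
  widthGap = solve-∀
  doubled : ∀ t → 8 * (2 * t) + 32 ≡ 8 * (suc t + (2 + t) + 1)
  doubled = solve-∀
  squareFits : (2 * W ∸ 1) * (2 * W ∸ 1) ≤ 8 * (suc t + fLower (suc X) + 1)
  squareFits = begin
    (2 * W ∸ 1) * (2 * W ∸ 1)        ≤⟨ *-mono-≤ (m∸n≤m (2 * W) 1) (m∸n≤m (2 * W) 1) ⟩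
    2 * W * (2 * W)                  ≤⟨ m≤m+n _ _ ⟩
    2 * W * (2 * W) + _              ≡⟨ sym (squareGap e d) ⟩
    8 * (X * suc X) + 32             ≡⟨ cong (λ v → 8 * v + 32) (sym (tri-double X)) ⟩
    8 * (2 * t) + 32                 ≡⟨ doubled t ⟩
    8 * (suc t + (2 + t) + 1)        ≤⟨ *-monoʳ-≤ 8 (+-monoˡ-≤ 1 (+-monoʳ-≤ (suc t) (m≤m⊔n (2 + t) 2236))) ⟩
    8 * (suc t + fLower (suc X) + 1) ∎
    where open ≤-Reasoning
  roomFits : W + 2 ≤ fLower (suc X)
  roomFits = ≤-trans (≤-reflexive (+-comm W 2)) (≤-trans (+-monoʳ-≤ 2 W≤t) (m≤m⊔n (2 + t) 2236))
    where
    W≤t : W ≤ t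
    W≤t = *-cancelˡ-≤ 2 (≤-trans (m≤m+n (2 * W) _)
                                  (≤-reflexive (trans (sym (widthGap e d)) (sym (tri-double X)))))

6e+5<2+tri : ∀ {e} → 14 ≤ e → 6 * e + 5 < 2 + tri e
6e+5<2+tri {suc e} 14≤1+e with m≤n⇒m<n∨m≡n 14≤1+e
... | inj₂ refl    = ≤ᵇ⇒≤ 90 93 tt
... | inj₁ 14<1+e = begin-strict
  6 * suc e + 5       ≡⟨ arithmetic e ⟩
  6 * e + 5 + 6       <⟨ +-mono-<-≤ (6e+5<2+tri 14≤e) (≤-trans (≤ᵇ⇒≤ 6 14 tt) 14≤e) ⟩
  2 + tri e + e       ∎
  where
  open ≤-Reasoning
  14≤e : 14 ≤ e
  14≤e = ≤-pred 14<1+e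
  arithmetic : ∀ e → 6 * suc e + 5 ≡ 6 * e + 5 + 6
  arithmetic = solve-∀

6e+5<K : ∀ {K} e → 84 ≤ K → 2 + tri e ≤ K → 6 * e + 5 < K
6e+5<K e 84≤K h with 14 ≤? e
... | no 14≰e = ≤-trans (s≤s (+-monoˡ-≤ 5 (*-monoʳ-≤ 6 (≤-pred (≰⇒> 14≰e))))) 84≤K
... | yes 14≤e = <-≤-trans (6e+5<2+tri 14≤e) h

widthFits : ∀ {K} e → 2 + tri e ≤ K → WidthFits K e
widthFits {K} e h with K <? 84
... | yes K<84 = widthFits-small K<84 h
... | no K≮84 with m≤n⇒∃[o]m+o≡n (6e+5<K e (≮⇒≥ K≮84) h)
...   | d , refl = widthFits-large e d

leastBelow-sound : ∀ (p : ℕ → Bool) B k → k < B → T (p k) → T (p (leastBelow p B))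
leastBelow-sound p (suc B) k k<B pk with p 0 in eq
... | true  = subst T (sym eq) tt
leastBelow-sound p (suc B) zero    k<B pk | false = ⊥-elim (subst T eq pk)
leastBelow-sound p (suc B) (suc k) k<B pk | false = leastBelow-sound (p ∘ suc) B k (≤-pred k<B) pk

leastBelow-minimal : ∀ (p : ℕ → Bool) B k → k < leastBelow p B → ¬ T (p k)
leastBelow-minimal p (suc B) k k<least pk with p 0 in eq
leastBelow-minimal p (suc B) k       ()      pk | true
leastBelow-minimal p (suc B) zero    k<least pk | false = subst T eq pk
leastBelow-minimal p (suc B) (suc k) k<least pk | false =
  leastBelow-minimal (p ∘ suc) B k (≤-pred k<least) pk

2n≤n[n+1] : ∀ n → 2 * n ≤ n * (n + 1)
2n≤n[n+1] zero    = z≤n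
2n≤n[n+1] (suc n) = ≤-trans (≤-reflexive (*-comm 2 (suc n))) (*-monoʳ-≤ (suc n) (s≤s (m≤n+m 1 n)))

fCriterion : ℕ → ℕ → Bool
fCriterion n k = (2 * n) ≤ᵇ (k * (k + 1))

f-spec : ∀ n → 2 * n ≤ f n * (f n + 1)
f-spec n = ≤ᵇ⇒≤ (2 * n) (f n * (f n + 1))
             (leastBelow-sound (fCriterion n) (suc n) n ≤-refl (≤⇒≤ᵇ (2n≤n[n+1] n)))

f-minimal : ∀ n k → k < f n → k * (k + 1) < 2 * n
f-minimal n k k<f = ≰⇒> (λ le → leastBelow-minimal (fCriterion n) (suc n) k k<f (≤⇒≤ᵇ le))

g+n≡tri : ∀ n → g n + n ≡ tri (suc (f n))
g+n≡tri n = trans (cong (_+ n) g≡) (m∸n+n≡m n≤tri)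
  where
  product≡ : f n * (f n + 1) ≡ tri (suc (f n)) * 2
  product≡ = trans (cong (f n *_) (+-comm (f n) 1))
                   (trans (sym (tri-double (f n))) (*-comm 2 (tri (suc (f n)))))
  g≡ : g n ≡ tri (suc (f n)) ∸ n
  g≡ = cong (_∸ n) (trans (cong (_/ 2) product≡) (m*n/n≡m (tri (suc (f n))) 2))
  n≤tri : n ≤ tri (suc (f n))
  n≤tri = *-cancelˡ-≤ 2 (≤-trans (f-spec n)
                                  (≤-reflexive (trans product≡ (*-comm (tri (suc (f n))) 2))))

g<f : ∀ n → 1 ≤ n → g n < f n
g<f n 1≤n with f n | f-spec n | f-minimal n | g+n≡tri n
... | zero  | 2n≤0 | _       | _     = ⊥-elim (n≮0 (≤-trans (*-monoʳ-≤ 2 1≤n) 2n≤0))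
... | suc k | _    | minimal | g+n≡ = <-of-split-tri (suc k) g+n≡ tri<n
  where
  tri<n : tri (suc k) < n
  tri<n = *-cancelˡ-< 2 (tri (suc k)) n
            (subst (_< 2 * n) (trans (cong (k *_) (+-comm k 1)) (sym (tri-double k))) (minimal k ≤-refl))

-- ≤⇒≤ᵇ turns the impossible 2 * 2500000 ≤ 2235 * 2236 into T false.
2236≤f : ∀ n → 2500000 ≤ n → 2236 ≤ f n
2236≤f n 2500000≤n = ≮⇒≥ λ f<2236 → ⊥-elim (≤⇒≤ᵇ (begin
  2 * 2500000           ≤⟨ *-monoʳ-≤ 2 2500000≤n ⟩
  2 * n                 ≤⟨ f-spec n ⟩
  f n * (f n + 1)       ≤⟨ *-mono-≤ (≤-pred f<2236) (+-monoˡ-≤ 1 (≤-pred f<2236)) ⟩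
  2235 * (2235 + 1)     ∎))
  where open ≤-Reasoning

BoundingSet : ℕ → ℕ → Set
BoundingSet m F = ∃[ W ] ∃[ A ] vol A ≡ m × PerimetersAtMost W A
                              × (2 * W ∸ 1) * (2 * W ∸ 1) ≤ 8 * (m + F + 1) × W + 2 ≤ F

boundingSet : ∀ m F → suc m ≤ F → 2236 ≤ F → BoundingSet m F
boundingSet m F m<F 2236≤F with 7 ≤? m
... | no 7≰m with linearlyBounded m
...   | A , volA , _ , perimA =
  8 , A , volA , PerimetersAtMost-mono A (+-monoˡ-≤ 2 (≤-pred (≰⇒> 7≰m))) perimA ,
  ≤-trans (≤ᵇ⇒≤ 225 (8 * 2236) tt)
          (*-monoʳ-≤ 8 (≤-trans 2236≤F (≤-trans (m≤n+m F m) (m≤m+n (m + F) 1)))) ,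
  ≤-trans (≤ᵇ⇒≤ 10 2236 tt) 2236≤F
boundingSet m F m<F 2236≤F | yes 7≤m with decompose m 7≤m
... | d with sharpSet d | widthFits (Decomposition.e d) (Decomposition.2+tri[e]≤K d)
...   | A , volA , perimA | squareFits , roomFits =
  width e K , A , volA , perimA ,
  ≤-trans squareFits (*-monoʳ-≤ 8 (+-monoˡ-≤ 1 (+-mono-≤ tri[K]<m fLower≤F))) ,
  ≤-trans roomFits fLower≤F
  where
  open Decomposition d
  fLower≤F : fLower K ≤ F
  fLower≤F = ⊔-lub (≤-trans (s≤s tri[K]<m) m<F) 2236≤F

square-mono-≤ : ∀ {a b} → a ≤ b → a * a ≤ b * b
square-mono-≤ a≤b = *-mono-≤ a≤b a≤b

leSqrtPlusHalf : ∀ {x W y} → x ≤ W → (2 * W ∸ 1) * (2 * W ∸ 1) ≤ 8 * y → LeSqrtPlusHalf x y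
leSqrtPlusHalf x≤W squareFits =
  inj₂ (≤-trans (square-mono-≤ (∸-monoˡ-≤ 1 (*-monoʳ-≤ 2 x≤W))) squareFits)

leSqrtPlusThreeHalves : ∀ {x W y} → x ≤ W → (2 * W ∸ 1) * (2 * W ∸ 1) ≤ 8 * y →
                        LeSqrtPlusThreeHalves x y
leSqrtPlusThreeHalves {W = W} x≤W squareFits =
  inj₂ (≤-trans (square-mono-≤ (≤-trans (∸-monoˡ-≤ 3 (*-monoʳ-≤ 2 x≤W)) (∸-monoʳ-≤ (2 * W) (s≤s z≤n))))
                squareFits)

Bounds : ℕ → ℕ → Set
Bounds m F = ((p : ℕ) → IsP m p → LeSqrtPlusHalf p (m + F + 1))
           × ((q : ℕ) → IsQ m q → LeSqrtPlusThreeHalves q (m + F + 1) × (q + 2 ≤ F))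

boundingSet⇒Bounds : ∀ {m F} → BoundingSet m F → Bounds m F
boundingSet⇒Bounds {m} {F} (W , A , volA , (perA , perCA) , squareFits , roomFits) =
  (λ p isP → leSqrtPlusHalf {y = m + F + 1} (≤-trans (proj₂ isP A volA) perA) squareFits) ,
  (λ q isQ → let q≤W = ≤-trans (proj₂ isQ A volA) perCA in
             leSqrtPlusThreeHalves {y = m + F + 1} q≤W squareFits , ≤-trans (+-monoˡ-≤ 2 q≤W) roomFits)

bounds : ∀ n → 2500000 ≤ n → Bounds (g n) (f n)
bounds n 2500000≤n = boundingSet⇒Bounds
  (boundingSet (g n) (f n) (g<f n (≤-trans (s≤s z≤n) 2500000≤n)) (2236≤f n 2500000≤n))

proposition17 : (∃[ N ] ((n : ℕ) → N ≤ n →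
                    ((p : ℕ) → IsP (g n) p → LeSqrtPlusHalf p (g n + f n + 1))
                  × ((q : ℕ) → IsQ (g n) q →
                       LeSqrtPlusThreeHalves q (g n + f n + 1) × (q + 2 ≤ f n))))
                × ((n : ℕ) → 2500000 ≤ n →
                    ((p : ℕ) → IsP (g n) p → LeSqrtPlusHalf p (g n + f n + 1))
                  × ((q : ℕ) → IsQ (g n) q →
                       LeSqrtPlusThreeHalves q (g n + f n + 1) × (q + 2 ≤ f n)))
proposition17 = (2500000 , bounds) , bounds
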